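{- Assume $\det(M - I) \not\equiv 0 \pmod{2^k}$. If $c_1 \vec x_1 + c_2 \vec x_2 = d_1 \vec x_1 + d_2 \vec x_2$, then $c_1 \equiv d_1 \pmod 2$.
   Context: Let $(\vec v, M)$ be an element of the affine group $\mathrm{AGL}_2(\mathbb{Z}/2^k\mathbb{Z})$ (specifically of the subgroup $I_k$ containing the image of the 2-adic arboreal representation attached to $E : y^2+xy = x^3+x^2-2x$ and $P=(2,2)$), with $\vec v$ a row vector in $(\mathbb{Z}/2^k\mathbb{Z})^2$ and $M \in \mathrm{GL}_2(\mathbb{Z}/2^k\mathbb{Z})$. Let $o$ be the smallest non-negative integer such that $2^o \vec v$ lies in the image of $I - M$ (acting on row vectors by right multiplication), and let $\vec x_1, \vec x_2$ be the first and second rows of $I - M$, so that $2^o \vec v = c_1 \vec x_1 + c_2 \vec x_2$ for some integers $c_1, c_2$ (not necessarily unique). Here $c_1, c_2, d_1, d_2 \in \mathbb{Z}/2^k\mathbb{Z}$. -}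

module Defs where

open import Data.Nat using (ℕ)
open import Data.Integer using (ℤ; +_; _+_; _-_; _*_; -_)
open import Data.Integer.Divisibility using (_∣_)
open import Data.Product using (_×_; _,_; ∃)
open import Relation.Nullary using (¬_)

-- Elements of ℤ/nℤ are represented by integer lifts; equality in ℤ/nℤ
-- is congruence modulo n.
_≡_[mod_] : ℤ → ℤ → ℤ → Set
a ≡ b [mod n ] = n ∣ (a - b)

pow2 : ℕ → ℤ
pow2 ℕ.zero    = + 1
pow2 (ℕ.suc k) = + 2 * pow2 k

Vec2 : Set
Vec2 = ℤ × ℤ

record Mat2 : Set where
  constructor mat
  field
    m11 m12 m21 m22 : ℤ
open Mat2 public

det : Mat2 → ℤ
det M = m11 M * m22 M - m12 M * m21 M

I2 : Mat2
I2 = mat (+ 1) (+ 0) (+ 0) (+ 1)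

_-ᴹ_ : Mat2 → Mat2 → Mat2
A -ᴹ B = mat (m11 A - m11 B) (m12 A - m12 B) (m21 A - m21 B) (m22 A - m22 B)

row₁ row₂ : Mat2 → Vec2
row₁ A = m11 A , m12 A
row₂ A = m21 A , m22 A

_·_ : ℤ → Vec2 → Vec2
c · (x , y) = c * x , c * y

_+ᵛ_ : Vec2 → Vec2 → Vec2
(x , y) +ᵛ (x' , y') = x + x' , y + y'

_≡ᵛ_[mod_] : Vec2 → Vec2 → ℤ → Set
(x , y) ≡ᵛ (x' , y') [mod n ] = (x ≡ x' [mod n ]) × (y ≡ y' [mod n ])

InGL2 : ℕ → Mat2 → Set
InGL2 k M = ∃ λ u → (det M * u) ≡ + 1 [mod pow2 k ]

module Submission where

-- Write A = I − M, with rows x₁, x₂.  Eliminating the second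
-- coordinate of the vector c₁x₁ + c₂x₂ (Cramer's rule) recovers c₁·det A
-- as an integer combination of its two coordinates.  Hence if
-- c₁x₁ + c₂x₂ ≡ d₁x₁ + d₂x₂ (mod n) then n ∣ (c₁ − d₁)·det A.  For a 2×2
-- matrix det (I − M) = det (M − I).  Taking n = 2^k: if c₁ − d₁ were odd,
-- it would be coprime to 2 and could be cancelled, giving 2^k ∣ det (M − I),
-- contrary to the hypothesis.  So c₁ − d₁ is even.

open import Defs
open import Data.Nat using (ℕ)
open import Data.Integer using (ℤ; +_)
open import Relation.Nullary using (¬_)

import Data.Nat as ℕ
import Data.Nat.Divisibility as ℕ
open import Data.Nat.Properties using (*-comm; *-assoc)
open import Data.Nat.Primality using (Prime; prime⇒nonZero; euclidsLemma; prime[2])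
open import Data.Integer using (_-_; _*_; _+_; ∣_∣)
import Data.Integer.Divisibility as ℤ
open import Data.Integer.Divisibility.Signed
  using (∣ᵤ⇒∣; ∣⇒∣ᵤ; ∣m∣n⇒∣m-n; ∣m⇒∣m*n) renaming (_∣_ to _∣ˢ_)
import Data.Integer.Properties as ℤ
open import Data.Integer.Tactic.RingSolver using (solve-∀)
open import Data.Product using (_,_)
open import Data.Sum using (inj₁; inj₂)
open import Relation.Nullary using (yes; no; contradiction)
open import Relation.Binary.PropositionalEquality
  renaming (_≡_ to _≐_) using (refl; sym; subst; subst₂)

-- A factor not divisible by the prime p can be cancelled from a
-- divisibility by p^k.  Induction on k: p divides e·D, hence D = q·p by
-- Euclid's lemma; cancelling one p reduces to p^k ∣ e·q.
prime-power-cancel : ∀ {p} → Prime p → ∀ k e D →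
  ¬ (p ℕ.∣ e) → (p ℕ.^ k) ℕ.∣ (e ℕ.* D) → (p ℕ.^ k) ℕ.∣ D
prime-power-cancel pp ℕ.zero e D _ _ = ℕ.1∣ D
prime-power-cancel {p} pp (ℕ.suc k) e D p∤e pᵏ⁺¹∣eD
  with euclidsLemma e D pp (ℕ.∣-trans (ℕ.m∣m*n (p ℕ.^ k)) pᵏ⁺¹∣eD)
... | inj₁ p∣e = contradiction p∣e p∤e
... | inj₂ (ℕ.divides q refl) = subst (p ℕ.* (p ℕ.^ k) ℕ.∣_) (*-comm p q)
        (ℕ.*-monoʳ-∣ p (prime-power-cancel pp k e q p∤e pᵏ∣eq))
  where
  instance _ = prime⇒nonZero pp
  regroup : e ℕ.* (q ℕ.* p) ≐ p ℕ.* (e ℕ.* q)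
  regroup rewrite *-comm q p | sym (*-assoc e p q) | *-comm e p | *-assoc p e q = refl
  pᵏ∣eq : (p ℕ.^ k) ℕ.∣ (e ℕ.* q)
  pᵏ∣eq = ℕ.*-cancelˡ-∣ p (subst (p ℕ.* (p ℕ.^ k) ℕ.∣_) regroup pᵏ⁺¹∣eD)

∣pow2∣ : ∀ k → ∣ pow2 k ∣ ≐ 2 ℕ.^ k
∣pow2∣ ℕ.zero = refl
∣pow2∣ (ℕ.suc k) rewrite ℤ.abs-* (+ 2) (pow2 k) | ∣pow2∣ k = refl

cancel-odd : ∀ k e D → ¬ (+ 2 ℤ.∣ e) → pow2 k ℤ.∣ (e * D) → pow2 k ℤ.∣ D
cancel-odd k e D e-odd 2ᵏ∣eD = subst (ℕ._∣ ∣ D ∣) (sym (∣pow2∣ k))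
  (prime-power-cancel prime[2] k ∣ e ∣ ∣ D ∣ e-odd
    (subst₂ ℕ._∣_ (∣pow2∣ k) (ℤ.abs-* e D) 2ᵏ∣eD))

cramer-first : ∀ c₁ c₂ d₁ d₂ p q r s →
  (c₁ - d₁) * (p * s - q * r)
    ≐ ((c₁ * p + c₂ * r) - (d₁ * p + d₂ * r)) * s
      - ((c₁ * q + c₂ * s) - (d₁ * q + d₂ * s)) * r
cramer-first = solve-∀

first-coefficient-mod : ∀ n (A : Mat2) c₁ c₂ d₁ d₂ →
  ((c₁ · row₁ A) +ᵛ (c₂ · row₂ A)) ≡ᵛ ((d₁ · row₁ A) +ᵛ (d₂ · row₂ A)) [mod n ] →
  n ℤ.∣ ((c₁ - d₁) * det A)
first-coefficient-mod n (mat p q r s) c₁ c₂ d₁ d₂ (first≡ , second≡) =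
  ∣⇒∣ᵤ (subst (n ∣ˢ_)
               (sym (cramer-first c₁ c₂ d₁ d₂ p q r s))
               (∣m∣n⇒∣m-n (∣m⇒∣m*n s (∣ᵤ⇒∣ {n} {Δ₁} first≡))
                          (∣m⇒∣m*n r (∣ᵤ⇒∣ {n} {Δ₂} second≡))))
  where
  Δ₁ Δ₂ : ℤ
  Δ₁ = (c₁ * p + c₂ * r) - (d₁ * p + d₂ * r)
  Δ₂ = (c₁ * q + c₂ * s) - (d₁ * q + d₂ * s)

-- For 2×2 matrices negation does not change the determinant.
det-I-M : ∀ M → det (I2 -ᴹ M) ≐ det (M -ᴹ I2)
det-I-M (mat a b c d) = identity a b c d
  where
  identity : ∀ a b c d →
    (+ 1 - a) * (+ 1 - d) - (+ 0 - b) * (+ 0 - c)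
      ≐ (a - + 1) * (d - + 1) - (b - + 0) * (c - + 0)
  identity = solve-∀

lemma4p8 : (k : ℕ) (M : Mat2) → InGL2 k M →
    ¬ (det (M -ᴹ I2) ≡ + 0 [mod pow2 k ]) →
    (c₁ c₂ d₁ d₂ : ℤ) →
    ((c₁ · row₁ (I2 -ᴹ M)) +ᵛ (c₂ · row₂ (I2 -ᴹ M)))
      ≡ᵛ ((d₁ · row₁ (I2 -ᴹ M)) +ᵛ (d₂ · row₂ (I2 -ᴹ M))) [mod pow2 k ] →
    c₁ ≡ d₁ [mod + 2 ]
lemma4p8 k M _ det≢0 c₁ c₂ d₁ d₂ same with 2 ℕ.∣? ∣ c₁ - d₁ ∣
... | yes even = even
... | no odd = contradiction det≡0 det≢0
  where
  2ᵏ∣Δdet : pow2 k ℤ.∣ ((c₁ - d₁) * det (M -ᴹ I2))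
  2ᵏ∣Δdet = subst (λ D → pow2 k ℤ.∣ ((c₁ - d₁) * D)) (det-I-M M)
              (first-coefficient-mod (pow2 k) (I2 -ᴹ M) c₁ c₂ d₁ d₂ same)
  det≡0 : det (M -ᴹ I2) ≡ + 0 [mod pow2 k ]
  det≡0 = subst (pow2 k ℤ.∣_) (sym (ℤ.+-identityʳ (det (M -ᴹ I2))))
            (cancel-odd k (c₁ - d₁) (det (M -ᴹ I2)) odd 2ᵏ∣Δdet)
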